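{- If $T$ is a strongly connected tournament on $n\ge 3$ vertices, then $1\le\overrightarrow{rvc}(T)\le\overrightarrow{srvc}(T)\le n-2$.
   Context: A tournament is a digraph in which every two distinct vertices are joined by exactly one arc (in one direction). A (directed) path is a sequence of distinct vertices $x_0,\dots,x_\ell$ with each $x_{i-1}x_i$ an arc; its length is $\ell$. A digraph is strongly connected if for every ordered pair $(u,v)$ there is a $u$–$v$ path; a $u$–$v$ geodesic is a shortest $u$–$v$ path. In a vertex-coloured digraph, a path is rainbow if its internal vertices have pairwise distinct colours. A vertex-colouring of a strongly connected digraph $D$ is rainbow vertex-connected if every ordered pair $(u,v)$ is joined by a rainbow $u$–$v$ path, and strongly rainbow vertex-connected if every ordered pair is joined by a rainbow $u$–$v$ geodesic. $\overrightarrow{rvc}(D)$ (resp. $\overrightarrow{srvc}(D)$) is the minimum number of colours in a rainbow vertex-connected (resp. strongly rainbow vertex-connected) vertex-colouring of $D$. -}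

module Defs where

open import Data.Nat using (ℕ; _≤_; _∸_)
open import Data.Fin using (Fin)
open import Data.Bool using (Bool; T)
open import Data.List using (List; []; _∷_; length; map)
open import Data.List.Relation.Unary.Unique.Propositional using (Unique)
open import Data.Product using (Σ; ∃; _×_)
open import Data.Sum using (_⊎_)
open import Relation.Nullary using (¬_)
open import Relation.Binary.PropositionalEquality using (_≡_)

Digraph : ℕ → Set
Digraph n = Fin n → Fin n → Bool

Arc : ∀ {n} → Digraph n → Fin n → Fin n → Set
Arc D u v = T (D u v)

IsTournament : ∀ {n} → Digraph n → Set
IsTournament {n} D =
  (∀ u → ¬ Arc D u u) ×
  (∀ u v → ¬ u ≡ v → (Arc D u v ⊎ Arc D v u) × ¬ (Arc D u v × Arc D v u))

-- Walk D u v xs : xs = x₀ … x_ℓ is the vertex sequence of a walk from u to v.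
data Walk {n} (D : Digraph n) : Fin n → Fin n → List (Fin n) → Set where
  here : ∀ {u} → Walk D u u (u ∷ [])
  step : ∀ {u w v xs} → Arc D u w → Walk D w v xs → Walk D u v (u ∷ xs)

IsPath : ∀ {n} → Digraph n → Fin n → Fin n → List (Fin n) → Set
IsPath D u v xs = Walk D u v xs × Unique xs

-- length of a path = number of arcs
pathLength : ∀ {A : Set} → List A → ℕ
pathLength xs = length xs ∸ 1

StronglyConnected : ∀ {n} → Digraph n → Set
StronglyConnected {n} D = ∀ (u v : Fin n) → ∃ λ xs → IsPath D u v xs

IsGeodesic : ∀ {n} → Digraph n → Fin n → Fin n → List (Fin n) → Set
IsGeodesic D u v xs =
  IsPath D u v xs × (∀ ys → IsPath D u v ys → pathLength xs ≤ pathLength ys)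

dropLast : ∀ {A : Set} → List A → List A
dropLast [] = []
dropLast (x ∷ []) = []
dropLast (x ∷ y ∷ ys) = x ∷ dropLast (y ∷ ys)

internal : ∀ {A : Set} → List A → List A
internal [] = []
internal (x ∷ xs) = dropLast xs

-- a vertex colouring with (at most) k colours
Colouring : ℕ → ℕ → Set
Colouring n k = Fin n → Fin k

Rainbow : ∀ {n k} → Colouring n k → List (Fin n) → Set
Rainbow c xs = Unique (map c (internal xs))

IsRVColouring : ∀ {n k} → Digraph n → Colouring n k → Set
IsRVColouring {n} D c =
  ∀ (u v : Fin n) → ∃ λ xs → IsPath D u v xs × Rainbow c xs

IsSRVColouring : ∀ {n k} → Digraph n → Colouring n k → Set
IsSRVColouring {n} D c =
  ∀ (u v : Fin n) → ∃ λ xs → IsGeodesic D u v xs × Rainbow c xs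

IsMinColours : ∀ {n} → (∀ {k} → Colouring n k → Set) → ℕ → Set
IsMinColours {n} P k =
  (Σ (Colouring n k) λ c → P c) × (∀ m → (c : Colouring n m) → P c → k ≤ m)

IsRVC : ∀ {n} → Digraph n → ℕ → Set
IsRVC D k = IsMinColours (IsRVColouring D) k

IsSRVC : ∀ {n} → Digraph n → ℕ → Set
IsSRVC D k = IsMinColours (IsSRVColouring D) k

-- Let u, v realise the diameter D of T. If y precedes z among the internal
-- vertices of an a–b geodesic, then d(y,z) + 2 ≤ d(a,b) ≤ D, and, since the
-- predecessor p of y cannot dominate z (that arc would shortcut the geodesic),
-- the tournament has z → p → y, so d(z,y) ≤ 2. Hence two vertices with
-- d(y,z) ≥ max(3, D − 1) never both occur inside one geodesic and may share a
-- colour. If D ≤ 2 no geodesic has two internal vertices at all. If D ≥ 4, let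
-- x₁ be an out-neighbour of u and w an in-neighbour of v: the pairs {u, w} and
-- {x₁, v} qualify. If D = 3, the pair {u, v} qualifies, together with either a
-- second far pair avoiding u and v or, failing that, with x₁ coloured like u and
-- v. Contracting two pairs leaves n − 2 colours. The minima rvc and srvc exist
-- because every property involved is decidable by exhaustive search.
module Submission where

open import Defs
open import Level using (0ℓ)
open import Data.Nat using (ℕ; zero; suc; _+_; _≤_; _<_; _∸_; z≤n; s≤s; _≟_)
open import Data.Nat.Properties
  using ( ≤-refl; ≤-reflexive; ≤-trans; ≤-antisym; ≤-pred; <-irrefl; <⇒≤; ≮⇒≥; ≰⇒>; ≤⇒≯; ≤∧≢⇒<
        ; m≤m+n; m≤n+m; n≤1+n; m≤n⇒m≤1+n; m≤n+m∸n; +-identityʳ; +-monoʳ-≤; +-cancelˡ-≤; ∸-monoˡ-≤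
        ; _≤?_; _<?_; anyUpTo?; module ≤-Reasoning)
open import Data.Nat.Induction using (<-rec)
open import Data.Nat.Tactic.RingSolver using (solve-∀)
open import Data.Fin as Fin using (Fin; punchOut)
open import Data.Fin.Properties using (any?; all?; pigeonhole; punchOut-injective; toℕ<n)
open import Data.List using (List; []; _∷_; _++_; length; map; lookup)
open import Data.List.Properties using (length-++; length-++-sucʳ; map-cong)
open import Data.List.Relation.Unary.Any using (here; there)
open import Data.List.Relation.Unary.All as All using (All; []; _∷_)
open import Data.List.Relation.Unary.All.Properties using (¬Any⇒All¬)
open import Data.List.Relation.Unary.AllPairs using (AllPairs; []; _∷_)
open import Data.List.Relation.Unary.AllPairs.Properties using (map⁺)
open import Data.List.Relation.Unary.Unique.Propositional using (Unique)
import Data.List.Relation.Unary.Unique.DecPropositional as UniqueDec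
open import Data.List.Membership.Propositional using (_∈_)
open import Data.List.Membership.Propositional.Properties using (∈-lookup; ∈-++⁺ʳ)
import Data.List.Membership.DecPropositional as MembershipDec
import Data.Vec.Functional as Vector
open import Data.Product using (Σ; ∃; ∃₂; ∃-syntax; _×_; _,_; proj₁; proj₂; swap; uncurry)
open import Data.Sum using (_⊎_; inj₁; inj₂; [_,_]′)
open import Function using (id; flip; _∘_)
open import Relation.Nullary using (¬_; Dec; yes; no; contradiction)
open import Relation.Nullary.Decidable using (T?; map′; ¬?; _×-dec_)
open import Relation.Unary using (Decidable)
open import Relation.Binary using (Rel; Symmetric)
open import Relation.Binary.PropositionalEquality
  using (_≡_; _≢_; refl; sym; trans; cong; subst; _≗_; module ≡-Reasoning)

Least : (ℕ → Set) → ℕ → Set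
Least Q k = Q k × (∀ m → Q m → k ≤ m)

least : {Q : ℕ → Set} → Decidable Q → ∀ {K} → Q K → ∃ (Least Q)
least {Q} Q? = <-rec (λ K → Q K → ∃ (Least Q)) search _
  where
  search : ∀ K → (∀ {J} → J < K → Q J → ∃ (Least Q)) → Q K → ∃ (Least Q)
  search K below qK with anyUpTo? Q? K
  ... | yes (J , J<K , qJ) = below J<K qJ
  ... | no none = K , qK , λ m qm → ≮⇒≥ λ m<K → none (m , m<K , qm)

argmax : ∀ {k} (f : Fin (suc k) → ℕ) → ∃ λ i → ∀ j → f j ≤ f i
argmax {zero} f = Fin.zero , λ { Fin.zero → ≤-refl }
argmax {suc k} f with argmax (f ∘ Fin.suc)
... | i , max with f Fin.zero ≤? f (Fin.suc i)
...   | yes le = Fin.suc i , λ { Fin.zero → le ; (Fin.suc j) → max j }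
...   | no nle = Fin.zero , λ { Fin.zero → ≤-refl ; (Fin.suc j) → ≤-trans (max j) (<⇒≤ (≰⇒> nle)) }

∃-function? : ∀ n {m} {P : (Fin n → Fin m) → Set} →
              (∀ {f g} → f ≗ g → P f → P g) → (∀ f → Dec (P f)) → Dec (∃ P)
∃-function? zero P-resp P? with P? (λ ())
... | yes p = yes (_ , p)
... | no ¬p = no λ (f , pf) → ¬p (P-resp (λ ()) pf)
∃-function? (suc n) P-resp P?
  with any? (λ x → ∃-function? n (λ f≗g → P-resp λ { Fin.zero → refl ; (Fin.suc i) → f≗g i })
                                 (P? ∘ (x Vector.∷_)))
... | yes (x , f , p) = yes (x Vector.∷ f , p)
... | no ¬p = no λ (f , pf) →
  ¬p (Vector.head f , Vector.tail f , P-resp (λ { Fin.zero → refl ; (Fin.suc i) → refl }) pf)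

∃-list? : ∀ {n} k {P : List (Fin n) → Set} →
          (∀ xs → Dec (P xs)) → (∀ {xs} → P xs → length xs ≤ k) → Dec (∃ P)
∃-list? zero P? bounded with P? []
... | yes p = yes ([] , p)
... | no ¬p = no λ { ([] , p) → ¬p p ; (_ ∷ _ , p) → contradiction (bounded p) λ () }
∃-list? (suc k) P? bounded with P? [] | any? (λ x → ∃-list? k (P? ∘ (x ∷_)) (≤-pred ∘ bounded))
... | yes p | _ = yes ([] , p)
... | no _  | yes (x , xs , p) = yes (x ∷ xs , p)
... | no ¬p | no ¬q = no λ { ([] , p) → ¬p p ; (x ∷ xs , p) → ¬q (x , xs , p) }

lookup-injective : ∀ {A : Set} {xs : List A} → Unique xs → ∀ {i j} → i Fin.< j → lookup xs i ≢ lookup xs j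
lookup-injective (x∉xs ∷ _) {Fin.zero} {Fin.suc j} _ = All.lookup x∉xs (∈-lookup j)
lookup-injective (_ ∷ u) {Fin.suc i} {Fin.suc j} (s≤s i<j) = lookup-injective u i<j

Unique⇒length≤ : ∀ {n} {xs : List (Fin n)} → Unique xs → length xs ≤ n
Unique⇒length≤ {xs = xs} u = ≮⇒≥ λ n<len →
  let (i , j , i<j , same) = pigeonhole n<len (lookup xs) in lookup-injective u i<j same

Unique-suffix : ∀ {A : Set} (P : List A) {Q} → Unique (P ++ Q) → Unique Q
Unique-suffix [] u = u
Unique-suffix (_ ∷ P) (_ ∷ u) = Unique-suffix P u

Unique⇒≢ : ∀ {A : Set} {y z : A} M R → Unique (y ∷ M ++ z ∷ R) → y ≢ z
Unique⇒≢ M R (y∉ ∷ _) = All.lookup y∉ (∈-++⁺ʳ M (here refl))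

pathLength-++ : ∀ {A : Set} (P : List A) {x ys} → pathLength (P ++ x ∷ ys) ≡ length P + length ys
pathLength-++ P {x} {ys} = trans (cong (_∸ 1) (length-++-sucʳ P x ys)) (length-++ P)

data InternalPair {A : Set} (xs : List A) (y z : A) : Set where
  internalPair : ∀ P p M q R → xs ≡ P ++ p ∷ y ∷ M ++ z ∷ q ∷ R → InternalPair xs y z

internalPair-≢ : ∀ {A : Set} {xs : List A} {y z} → Unique xs → InternalPair xs y z → y ≢ z
internalPair-≢ u (internalPair P p M q R refl) with Unique-suffix P u
... | _ ∷ u′ = Unique⇒≢ M (q ∷ R) u′

pathLength-internalPair : ∀ {A : Set} P (p y : A) M z q R →
  pathLength (P ++ p ∷ y ∷ M ++ z ∷ q ∷ R) ≡ 3 + (length P + length M + length R)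
pathLength-internalPair P p y M z q R = begin
  pathLength (P ++ p ∷ y ∷ M ++ z ∷ q ∷ R)          ≡⟨ pathLength-++ P ⟩
  length P + suc (length (M ++ z ∷ q ∷ R))         ≡⟨ cong (λ l → length P + suc l) (length-++ M) ⟩
  length P + suc (length M + suc (suc (length R)))  ≡⟨ rearrange (length P) (length M) (length R) ⟩
  3 + (length P + length M + length R)              ∎
  where
  open ≡-Reasoning
  rearrange : ∀ l m r → l + suc (m + suc (suc r)) ≡ 3 + (l + m + r)
  rearrange = solve-∀

internalPair-pathLength≥3 : ∀ {A : Set} {xs : List A} {y z} → InternalPair xs y z → 3 ≤ pathLength xs
internalPair-pathLength≥3 (internalPair P p M q R refl) =
  subst (3 ≤_) (sym (pathLength-internalPair P p _ M _ q R)) (m≤m+n 3 _)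

lengths≤0 : ∀ {A : Set} (P M R : List A) → length P + length M + length R ≤ 0 → P ≡ [] × M ≡ [] × R ≡ []
lengths≤0 [] [] [] _ = refl , refl , refl
lengths≤0 (_ ∷ _) _ _ ()
lengths≤0 [] (_ ∷ _) _ ()
lengths≤0 [] [] (_ ∷ _) ()

internalPair-pathLength≤3 : ∀ {A : Set} {xs : List A} {y z} → InternalPair xs y z → pathLength xs ≤ 3 →
                            ∃₂ λ p q → xs ≡ p ∷ y ∷ z ∷ q ∷ []
internalPair-pathLength≤3 (internalPair P p M q R refl) ≤3
  with lengths≤0 P M R (+-cancelˡ-≤ 3 _ 0 (subst (_≤ 3) (pathLength-internalPair P p _ M _ q R) ≤3))
... | refl , refl , refl = p , q , refl

All-dropLast : ∀ {A : Set} {P : A → Set} ws → (∀ M {z} q R → ws ≡ M ++ z ∷ q ∷ R → P z) →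
               All P (dropLast ws)
All-dropLast [] _ = []
All-dropLast (w ∷ []) _ = []
All-dropLast (w ∷ w′ ∷ ws) h =
  h [] w′ ws refl ∷ All-dropLast (w′ ∷ ws) λ M q R eq → h (w ∷ M) q R (cong (w ∷_) eq)

AllPairs-internal : ∀ {A : Set} {Q : A → A → Set} xs → (∀ {y z} → InternalPair xs y z → Q y z) →
                    AllPairs Q (internal xs)
AllPairs-internal [] _ = []
AllPairs-internal (x ∷ []) _ = []
AllPairs-internal (x ∷ w ∷ []) _ = []
AllPairs-internal {Q = Q} (x ∷ w ∷ w′ ∷ ws) h =
  All-dropLast (w′ ∷ ws) pairedWith-w ∷ AllPairs-internal (w ∷ w′ ∷ ws) (h ∘ extend)
  where
  pairedWith-w : ∀ M {z} q R → w′ ∷ ws ≡ M ++ z ∷ q ∷ R → Q w z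
  pairedWith-w M q R eq = h (internalPair [] x M q R (cong (λ ys → x ∷ w ∷ ys) eq))
  extend : ∀ {y z} → InternalPair (w ∷ w′ ∷ ws) y z → InternalPair (x ∷ w ∷ w′ ∷ ws) y z
  extend (internalPair P p M q R eq) = internalPair (x ∷ P) p M q R (cong (x ∷_) eq)

rainbow⁺ : ∀ {n k} {c : Colouring n k} xs → (∀ {y z} → InternalPair xs y z → c y ≢ c z) → Rainbow c xs
rainbow⁺ xs h = map⁺ (AllPairs-internal xs h)

module _ {n} {D : Digraph n} where
  open MembershipDec (Fin._≟_ {n}) using (_∈?_)

  walk-head : ∀ {a b x xs} → Walk D a b (x ∷ xs) → a ≡ x
  walk-head here = refl
  walk-head (step _ _) = refl

  walk-uncons : ∀ {a b y ys} → Walk D a b (a ∷ y ∷ ys) → Arc D a y × Walk D y b (y ∷ ys)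
  walk-uncons (step ay here) = ay , here
  walk-uncons (step ay (step yz w)) = ay , step yz w

  infixr 5 _++ʷ_
  _++ʷ_ : ∀ {a x b xs ys} → Walk D a x xs → Walk D x b (x ∷ ys) → Walk D a b (xs ++ ys)
  here ++ʷ w = w
  step e w₁ ++ʷ w = step e (w₁ ++ʷ w)

  walk-split : ∀ P {a b x ys} → Walk D a b (P ++ x ∷ ys) →
               Walk D a x (P ++ x ∷ []) × Walk D x b (x ∷ ys)
  walk-split [] w with walk-head w
  ... | refl = here , w
  walk-split (p ∷ []) (step e w) with walk-head w
  ... | refl = step e here , w
  walk-split (p ∷ p′ ∷ P) (step e w) =
    let (w₁ , w₂) = walk-split (p′ ∷ P) w in step e w₁ , w₂

  walk-segments : ∀ P {a b p y z} M Z → Walk D a b (P ++ p ∷ y ∷ M ++ z ∷ Z) →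
                  Walk D a p (P ++ p ∷ []) × Arc D p y × Walk D y z (y ∷ M ++ z ∷ []) × Walk D z b (z ∷ Z)
  walk-segments P M Z w =
    let (ap , pb) = walk-split P w
        (py , yb) = walk-uncons pb
        (yz , zb) = walk-split (_ ∷ M) yb
    in ap , py , yz , zb

  out-neighbour : ∀ {a b xs} → a ≢ b → Walk D a b xs → ∃ (Arc D a)
  out-neighbour a≢b here = contradiction refl a≢b
  out-neighbour _ (step ax _) = _ , ax

  in-neighbour : ∀ {a b xs} → a ≢ b → Walk D a b xs → ∃ λ w → Arc D w b
  in-neighbour a≢b here = contradiction refl a≢b
  in-neighbour _ (step ax w) = last-arc ax w
    where
    last-arc : ∀ {a x b xs} → Arc D a x → Walk D x b xs → ∃ λ w → Arc D w b
    last-arc ax here = _ , ax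
    last-arc _ (step xy w) = last-arc xy w

  path-from-member : ∀ {a x b xs} → Walk D x b xs → Unique xs → a ∈ xs →
                     ∃[ ys ] IsPath D a b ys × length ys ≤ length xs
  path-from-member w u (here refl) with walk-head w
  ... | refl = _ , (w , u) , ≤-refl
  path-from-member (step _ w) (_ ∷ u) (there a∈xs) =
    let (ys , p , le) = path-from-member w u a∈xs in ys , p , m≤n⇒m≤1+n le

  walk⇒path : ∀ {a b xs} → Walk D a b xs → ∃[ ys ] IsPath D a b ys × length ys ≤ length xs
  walk⇒path here = _ , (here , ([] ∷ [])) , ≤-refl
  walk⇒path {a} (step e w) with walk⇒path w
  ... | ys , (w′ , u) , le with a ∈? ys
  ...   | yes a∈ys = let (zs , p , le′) = path-from-member w′ u a∈ys in
                     zs , p , m≤n⇒m≤1+n (≤-trans le′ le)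
  ...   | no a∉ys = a ∷ ys , (step e w′ , ¬Any⇒All¬ ys a∉ys ∷ u) , s≤s le

module _ {n} (D : Digraph n) where

  walkFrom? : ∀ a b ys → Dec (Walk D a b (a ∷ ys))
  walkFrom? a b [] = map′ (λ { refl → here }) (λ { here → refl }) (a Fin.≟ b)
  walkFrom? a b (y ∷ ys) = map′ (uncurry step) walk-uncons (T? (D a y) ×-dec walkFrom? y b ys)

  walk? : ∀ a b xs → Dec (Walk D a b xs)
  walk? a b [] = no λ ()
  walk? a b (x ∷ xs) with a Fin.≟ x
  ... | yes refl = walkFrom? a b xs
  ... | no a≢x = no λ w → a≢x (walk-head w)

  path? : ∀ a b xs → Dec (IsPath D a b xs)
  path? a b xs = walk? a b xs ×-dec UniqueDec.unique? Fin._≟_ xs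

  ∃-path? : ∀ a b {P : List (Fin n) → Set} → (∀ xs → Dec (P xs)) → Dec (∃[ xs ] IsPath D a b xs × P xs)
  ∃-path? a b P? = ∃-list? n (λ xs → path? a b xs ×-dec P? xs) (λ (p , _) → Unique⇒length≤ (proj₂ p))

  geodesic? : ∀ a b xs → Dec (IsGeodesic D a b xs)
  geodesic? a b xs with path? a b xs | ∃-path? a b (λ ys → pathLength ys <? pathLength xs)
  ... | no ¬p | _ = no (¬p ∘ proj₁)
  ... | yes p | yes (ys , q , shorter) = no λ (_ , min) → ≤⇒≯ (min ys q) shorter
  ... | yes p | no none = yes (p , λ ys q → ≮⇒≥ λ shorter → none (ys , q , shorter))

module _ {n k} (D : Digraph n) (c : Colouring n k) where

  rainbow? : ∀ xs → Dec (Rainbow c xs)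
  rainbow? xs = UniqueDec.unique? Fin._≟_ (map c (internal xs))

  isSRVColouring? : Dec (IsSRVColouring D c)
  isSRVColouring? = all? λ a → all? λ b →
    ∃-list? n (λ xs → geodesic? D a b xs ×-dec rainbow? xs) (λ ((p , _) , _) → Unique⇒length≤ (proj₂ p))

  isRVColouring? : Dec (IsRVColouring D c)
  isRVColouring? = all? λ a → all? λ b → ∃-path? D a b rainbow?

rainbow-resp : ∀ {n k} {c c′ : Colouring n k} → c ≗ c′ → ∀ {xs} → Rainbow c xs → Rainbow c′ xs
rainbow-resp c≗c′ {xs} = subst Unique (map-cong c≗c′ (internal xs))

module _ {n k} {D : Digraph n} {c c′ : Colouring n k} (c≗c′ : c ≗ c′) where

  isSRVColouring-resp : IsSRVColouring D c → IsSRVColouring D c′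
  isSRVColouring-resp srv a b = let (xs , g , r) = srv a b in xs , g , rainbow-resp c≗c′ {xs} r

  isRVColouring-resp : IsRVColouring D c → IsRVColouring D c′
  isRVColouring-resp rv a b = let (xs , p , r) = rv a b in xs , p , rainbow-resp c≗c′ {xs} r

isSRVColouring⇒isRVColouring : ∀ {n k} {D : Digraph n} {c : Colouring n k} →
                                IsSRVColouring D c → IsRVColouring D c
isSRVColouring⇒isRVColouring srv a b = let (xs , (p , _) , r) = srv a b in xs , p , r

module _ {n} (P : ∀ {k} → Colouring n k → Set) (P? : ∀ {k} (c : Colouring n k) → Dec (P c))
         (P-resp : ∀ {k} {c c′ : Colouring n k} → c ≗ c′ → P c → P c′) where

  minColours : ∀ {k} {c : Colouring n k} → P c → ∃ λ r → IsMinColours P r × r ≤ k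
  minColours {k} {c} pc with least (λ j → ∃-function? n P-resp P?) (c , pc)
  ... | r , q , min = r , (q , λ m c′ p → min m (c′ , p)) , min k (c , pc)

colours≥1 : ∀ {n k} → Colouring (suc n) k → 1 ≤ k
colours≥1 c = ≤-trans (s≤s z≤n) (toℕ<n (c Fin.zero))

module _ {k} {b e : Fin (suc (suc k))} (b≢e : b ≢ e) where

  Avoiding : Set
  Avoiding = Σ (Fin (suc (suc k))) λ x → x ≢ b × x ≢ e

  private
    apart : ((x , _) : Avoiding) → b ≢ x
    apart (_ , x≢b , _) = x≢b ∘ sym

    apart′ : (s : Avoiding) → punchOut b≢e ≢ punchOut (apart s)
    apart′ s@(_ , _ , x≢e) same = x≢e (sym (punchOut-injective b≢e (apart s) same))

  remove₂ : Avoiding → Fin k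
  remove₂ s = punchOut (apart′ s)

  remove₂-injective : ∀ s t → remove₂ s ≡ remove₂ t → proj₁ s ≡ proj₁ t
  remove₂-injective s t = punchOut-injective (apart s) (apart t) ∘ punchOut-injective (apart′ s) (apart′ t)

module _ {k} (R : Rel (Fin (suc (suc k))) 0ℓ) (R-sym : Symmetric R)
         {b e a a′ : Fin (suc (suc k))} (b≢e : b ≢ e)
         (a≢b : a ≢ b) (a≢e : a ≢ e) (a′≢b : a′ ≢ b) (a′≢e : a′ ≢ e)
         (Rba : R b a) (Rea′ : R e a′) (Rbe : a ≡ a′ → R b e) where

  representative : Fin (suc (suc k)) → Avoiding b≢e
  representative x with x Fin.≟ b | x Fin.≟ e
  ... | yes _ | _ = a , a≢b , a≢e
  ... | no _ | yes _ = a′ , a′≢b , a′≢e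
  ... | no x≢b | no x≢e = x , x≢b , x≢e

  contract₂ : Fin (suc (suc k)) → Fin k
  contract₂ = remove₂ b≢e ∘ representative

  representative-collision : ∀ y z → proj₁ (representative y) ≡ proj₁ (representative z) → y ≡ z ⊎ R y z
  representative-collision y z same with y Fin.≟ b | y Fin.≟ e | z Fin.≟ b | z Fin.≟ e
  ... | yes refl | _ | yes refl | _ = inj₁ refl
  ... | yes refl | _ | no _ | yes refl = inj₂ (Rbe same)
  ... | yes refl | _ | no _ | no _ = inj₂ (subst (R b) same Rba)
  ... | no _ | yes refl | yes refl | _ = inj₂ (R-sym (Rbe (sym same)))
  ... | no _ | yes refl | no _ | yes refl = inj₁ refl
  ... | no _ | yes refl | no _ | no _ = inj₂ (subst (R e) same Rea′)
  ... | no _ | no _ | yes refl | _ = inj₂ (R-sym (subst (R b) (sym same) Rba))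
  ... | no _ | no _ | no _ | yes refl = inj₂ (R-sym (subst (R e) (sym same) Rea′))
  ... | no _ | no _ | no _ | no _ = inj₁ same

  contract₂-collision : ∀ y z → contract₂ y ≡ contract₂ z → y ≡ z ⊎ R y z
  contract₂-collision y z =
    representative-collision y z ∘ remove₂-injective b≢e (representative y) (representative z)

3≰2 : ¬ 3 ≤ 2
3≰2 (s≤s (s≤s ()))

module Geodesics {n} (D : Digraph n) (sc : StronglyConnected D) where

  -- Abstract: d is used only through the lemmas below, and unfolding the
  -- exhaustive search behind it makes type checking blow up.
  abstract
    geodesic : ∀ a b → ∃ (IsGeodesic D a b)
    geodesic a b with least (λ k → ∃-path? D a b (λ xs → pathLength xs ≟ k)) (proj₁ (sc a b) , proj₂ (sc a b) , refl)
    ... | _ , (xs , p , refl) , min = xs , p , λ ys q → min _ (ys , q , refl)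

  d : Fin n → Fin n → ℕ
  d a b = pathLength (proj₁ (geodesic a b))

  geodesic-walk : ∀ a b → Walk D a b (proj₁ (geodesic a b))
  geodesic-walk a b = proj₁ (proj₁ (proj₂ (geodesic a b)))

  d-walk : ∀ {a b xs} → Walk D a b xs → d a b ≤ pathLength xs
  d-walk {a} {b} w =
    let (ys , p , ys≤xs) = walk⇒path w in
    ≤-trans (proj₂ (proj₂ (geodesic a b)) ys p) (∸-monoˡ-≤ 1 ys≤xs)

  geodesic-length : ∀ {a b xs} → IsGeodesic D a b xs → pathLength xs ≡ d a b
  geodesic-length {a} {b} (p , min) = ≤-antisym (min _ (proj₁ (proj₂ (geodesic a b)))) (d-walk (proj₁ p))

  d-prependArc : ∀ {a x} b → Arc D a x → d a b ≤ suc (d x b)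
  d-prependArc {x = x} b ax = ≤-trans (d-walk (step ax (geodesic-walk x b))) (m≤n+m∸n _ 1)

  d-appendArc : ∀ {w b} a → Arc D w b → d a b ≤ suc (d a w)
  d-appendArc {w} {b} a wb = begin
    d a b                       ≤⟨ d-walk (geodesic-walk a w ++ʷ step wb here) ⟩
    pathLength (xs ++ b ∷ [])   ≡⟨ pathLength-++ xs ⟩
    length xs + 0               ≡⟨ +-identityʳ _ ⟩
    length xs                   ≤⟨ m≤n+m∸n _ 1 ⟩
    suc (d a w)                 ∎
    where
    open ≤-Reasoning
    xs = proj₁ (geodesic a w)

  no-shortcut : ∀ P {a b p y z} M Z → IsGeodesic D a b (P ++ p ∷ y ∷ M ++ z ∷ Z) → ¬ Arc D p z
  no-shortcut P {a} {b} {p} {y} {z} M Z g@((w , _) , _) pz =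
    let (ap , _ , _ , zb) = walk-segments P M Z w in
    <-irrefl refl (begin-strict
      d a b                                        ≤⟨ d-walk (ap ++ʷ step pz zb) ⟩
      pathLength ((P ++ p ∷ []) ++ z ∷ Z)          ≡⟨ pathLength-++ (P ++ p ∷ []) ⟩
      length (P ++ p ∷ []) + length Z              ≡⟨ cong (_+ length Z) (length-++ P) ⟩
      length P + 1 + length Z                      <⟨ shorter (length P) (length M) (length Z) ⟩
      length P + suc (length M + suc (length Z))   ≡⟨ cong (λ l → length P + suc l) (length-++ M) ⟨
      length P + length (y ∷ M ++ z ∷ Z)           ≡⟨ pathLength-++ P ⟨
      pathLength (P ++ p ∷ y ∷ M ++ z ∷ Z)         ≡⟨ geodesic-length g ⟩
      d a b                                        ∎)
    where
    open ≤-Reasoning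
    rearrange : ∀ l m r → suc (l + 1 + r + m) ≡ l + suc (m + suc r)
    rearrange = solve-∀
    shorter : ∀ l m r → l + 1 + r < l + suc (m + suc r)
    shorter l m r = subst (l + 1 + r <_) (rearrange l m r) (s≤s (m≤m+n (l + 1 + r) m))

  internalPair-far : ∀ {a b xs y z} → IsGeodesic D a b xs → InternalPair xs y z → 2 + d y z ≤ d a b
  internalPair-far {a} {b} {y = y} {z} g@((w , _) , _) (internalPair P p M q R refl) =
    let (_ , _ , yz , _) = walk-segments P M (q ∷ R) w in begin
      2 + d y z                                 ≤⟨ +-monoʳ-≤ 2 (d-walk yz) ⟩
      2 + pathLength (y ∷ M ++ z ∷ [])          ≡⟨ cong (2 +_) (pathLength-++ (y ∷ M)) ⟩
      2 + (suc (length M) + 0)                  ≡⟨ rearrange (length M) ⟩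
      3 + length M                              ≤⟨ +-monoʳ-≤ 3 (≤-trans (m≤n+m _ (length P)) (m≤m+n _ (length R))) ⟩
      3 + (length P + length M + length R)      ≡⟨ pathLength-internalPair P p y M z q R ⟨
      pathLength (P ++ p ∷ y ∷ M ++ z ∷ q ∷ R)  ≡⟨ geodesic-length g ⟩
      d a b                                     ∎
    where
    open ≤-Reasoning
    rearrange : ∀ m → 2 + (suc m + 0) ≡ 3 + m
    rearrange = solve-∀

  internalPair⇒d≥3 : ∀ {a b xs y z} → IsGeodesic D a b xs → InternalPair xs y z → 3 ≤ d a b
  internalPair⇒d≥3 g yz = subst (3 ≤_) (geodesic-length g) (internalPair-pathLength≥3 yz)

  Separated : Fin n → Fin n → Set
  Separated y z = ∀ {a b xs} → IsGeodesic D a b xs → ¬ InternalPair xs y z × ¬ InternalPair xs z y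

  separated-sym : ∀ {y z} → Separated y z → Separated z y
  separated-sym sep g = swap (sep g)

  small-separated : (∀ a b → d a b ≤ 2) → ∀ {y z} → Separated y z
  small-separated diameter {a = a} {b} g = no-pair , no-pair
    where
    no-pair : ∀ {y z} → ¬ InternalPair _ y z
    no-pair yz = 3≰2 (≤-trans (internalPair⇒d≥3 g yz) (diameter a b))

  isSRVColouring⁺ : ∀ {k} (c : Colouring n k) → (∀ y z → c y ≡ c z → y ≡ z ⊎ Separated y z) →
                    IsSRVColouring D c
  isSRVColouring⁺ c sharing a b =
    let (xs , g) = geodesic a b in
    xs , g , rainbow⁺ xs λ {y} {z} yz same →
      [ internalPair-≢ (proj₂ (proj₁ g)) yz , (λ sep → proj₁ (sep g) yz) ]′ (sharing y z same)

module Tournament {n} (T : Digraph n) (tour : IsTournament T) (sc : StronglyConnected T) where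
  open Geodesics T sc

  irreflexive : ∀ a → ¬ Arc T a a
  irreflexive = proj₁ tour

  arc⇒≢ : ∀ {a b} → Arc T a b → a ≢ b
  arc⇒≢ ab refl = irreflexive _ ab

  asymmetric : ∀ {a b} → Arc T a b → ¬ Arc T b a
  asymmetric ab ba = proj₂ (proj₂ tour _ _ (arc⇒≢ ab)) (ab , ba)

  reverse-arc : ∀ {a b} → a ≢ b → ¬ Arc T a b → Arc T b a
  reverse-arc a≢b ¬ab = [ flip contradiction ¬ab , id ]′ (proj₁ (proj₂ tour _ _ a≢b))

  back-arc : ∀ P {a b p y z} M Z → IsGeodesic T a b (P ++ p ∷ y ∷ M ++ z ∷ Z) → Arc T z p
  back-arc P {y = y} M Z g =
    reverse-arc (Unique⇒≢ (y ∷ M) Z (Unique-suffix P (proj₂ (proj₁ g)))) (no-shortcut P M Z g)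

  internalPair-back : ∀ {a b xs y z} → IsGeodesic T a b xs → InternalPair xs y z → d z y ≤ 2
  internalPair-back g (internalPair P p M q R refl) =
    let (_ , py , _ , _) = walk-segments P M (q ∷ R) (proj₁ (proj₁ g)) in
    d-walk (step (back-arc P M (q ∷ R) g) (step py here))

  short-internalPair-arcs : ∀ {a b xs y z} → IsGeodesic T a b xs → InternalPair xs y z → d a b ≤ 3 →
                           Arc T y z × Arc T z a × Arc T z b
  short-internalPair-arcs g yz ≤3 with internalPair-pathLength≤3 yz (subst (_≤ 3) (sym (geodesic-length g)) ≤3)
  ... | _ , q , refl with g
  ... | (step _ (step y→z (step z→b here)) , _) , _ = y→z , back-arc [] [] (q ∷ []) g , z→b

  far-separated : ∀ {diam y z} → (∀ a b → d a b ≤ diam) → 3 ≤ d y z → diam ≤ suc (d y z) → Separated y z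
  far-separated diameter 3≤yz near {a} {b} g =
    (λ yz → <-irrefl refl (≤-trans (internalPair-far g yz) (≤-trans (diameter a b) near))) ,
    (λ zy → 3≰2 (≤-trans 3≤yz (internalPair-back g zy)))

module Construction {m} (T : Digraph (3 + m)) (tour : IsTournament T) (sc : StronglyConnected T) where
  open Geodesics T sc
  open Tournament T tour sc

  diametralPair : ∃₂ λ u v → ∀ a b → d a b ≤ d u v
  diametralPair =
    let (u , maximal) = argmax (λ a → d a (farthest a)) in
    u , farthest u , λ a b → ≤-trans (proj₂ (argmax (d a)) b) (maximal a)
    where
    farthest : Fin (3 + m) → Fin (3 + m)
    farthest a = proj₁ (argmax (d a))

  SRVColouring : Set
  SRVColouring = Σ (Colouring (3 + m) (suc m)) (IsSRVColouring T)

  contractedColouring : ∀ {b e a a′} → b ≢ e → a ≢ b → a ≢ e → a′ ≢ b → a′ ≢ e →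
                        Separated b a → Separated e a′ → (a ≡ a′ → Separated b e) → SRVColouring
  contractedColouring b≢e a≢b a≢e a′≢b a′≢e ba ea′ be =
    contract₂ Separated separated-sym b≢e a≢b a≢e a′≢b a′≢e ba ea′ be ,
    isSRVColouring⁺ _ (contract₂-collision Separated separated-sym b≢e a≢b a≢e a′≢b a′≢e ba ea′ be)

  module Diametral {u v} (diametral : ∀ a b → d a b ≤ d u v) where

    module LargeDiameter (3≤diam : 3 ≤ d u v) where

      separated-vu : Separated v u
      separated-vu = separated-sym (far-separated diametral 3≤diam (n≤1+n _))

      diam≰2 : ¬ d u v ≤ 2
      diam≰2 ≤2 = 3≰2 (≤-trans 3≤diam ≤2)

      u≢v : u ≢ v
      u≢v refl = diam≰2 (≤-trans (d-walk here) z≤n)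

      ¬u→v : ¬ Arc T u v
      ¬u→v uv = diam≰2 (≤-trans (d-walk (step uv here)) (s≤s z≤n))

      x₁ : Fin (3 + m)
      x₁ = proj₁ (out-neighbour u≢v (geodesic-walk u v))

      u→x₁ : Arc T u x₁
      u→x₁ = proj₂ (out-neighbour u≢v (geodesic-walk u v))

      w : Fin (3 + m)
      w = proj₁ (in-neighbour u≢v (geodesic-walk u v))

      w→v : Arc T w v
      w→v = proj₂ (in-neighbour u≢v (geodesic-walk u v))

      ¬x₁→v : ¬ Arc T x₁ v
      ¬x₁→v x₁v = diam≰2 (≤-trans (d-prependArc v u→x₁) (s≤s (d-walk (step x₁v here))))

      x₁≢v : x₁ ≢ v
      x₁≢v x₁≡v = ¬u→v (subst (Arc T u) x₁≡v u→x₁)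

      u≢w : u ≢ w
      u≢w u≡w = ¬u→v (subst (λ c → Arc T c v) (sym u≡w) w→v)

      x₁≢w : x₁ ≢ w
      x₁≢w x₁≡w = ¬x₁→v (subst (λ c → Arc T c v) (sym x₁≡w) w→v)

      diameter≥4 : 4 ≤ d u v → SRVColouring
      diameter≥4 4≤diam =
        contractedColouring (arc⇒≢ w→v) u≢w u≢v x₁≢w x₁≢v
          (separated-sym (far-separated diametral (≤-pred (≤-trans 4≤diam diam≤uw)) diam≤uw))
          (separated-sym (far-separated diametral (≤-pred (≤-trans 4≤diam diam≤x₁v)) diam≤x₁v))
          (λ u≡x₁ → contradiction u≡x₁ (arc⇒≢ u→x₁))
        where
        diam≤uw = d-appendArc u w→v
        diam≤x₁v = d-prependArc v u→x₁

      module Diameter3 (diam≡3 : d u v ≡ 3) where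

        FarPairAvoiding : Fin (3 + m) → Fin (3 + m) → Set
        FarPairAvoiding s t = 3 ≤ d s t × s ≢ u × s ≢ v × t ≢ u × t ≢ v

        d≤3 : ∀ a b → d a b ≤ 3
        d≤3 a b = ≤-trans (diametral a b) (≤-reflexive diam≡3)

        viaFarPair : ∀ {s t} → FarPairAvoiding s t → SRVColouring
        viaFarPair {s} {t} (3≤st , s≢u , s≢v , t≢u , t≢v) =
          contractedColouring (t≢v ∘ sym) u≢v (t≢u ∘ sym) s≢v s≢t
            separated-vu
            (separated-sym (far-separated d≤3 3≤st (≤-trans 3≤st (n≤1+n _))))
            (λ u≡s → contradiction (sym u≡s) s≢u)
          where
          s≢t : s ≢ t
          s≢t refl = 3≰2 (≤-trans 3≤st (≤-trans (d-walk here) z≤n))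

        -- Out-neighbours of x₁ avoid u and v, so an internal pair ending in x₁
        -- would have the geodesic's endpoints as a far pair avoiding u and v.
        viaTriple : (∀ {s t} → ¬ FarPairAvoiding s t) → SRVColouring
        viaTriple none =
          contractedColouring (x₁≢v ∘ sym) u≢v (arc⇒≢ u→x₁) u≢v (arc⇒≢ u→x₁)
            separated-vu
            (separated-sym (separated-x₁ (inj₁ refl)))
            (λ _ → separated-x₁ (inj₂ refl))
          where
          x₁-out : ∀ {c} → Arc T x₁ c → c ≢ u × c ≢ v
          x₁-out x₁→c = (λ { refl → asymmetric u→x₁ x₁→c }) , (λ { refl → ¬x₁→v x₁→c })

          separated-x₁ : ∀ {y} → y ≡ u ⊎ y ≡ v → Separated y x₁
          separated-x₁ y∈uv {a} {b} g =
            (λ yx₁ → let (_ , x₁→a , x₁→b) = short-internalPair-arcs g yx₁ (d≤3 a b)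
                         (a≢u , a≢v) = x₁-out x₁→a
                         (b≢u , b≢v) = x₁-out x₁→b
                     in none (internalPair⇒d≥3 g yx₁ , a≢u , a≢v , b≢u , b≢v)) ,
            (λ x₁y → let (x₁→y , _ , _) = short-internalPair-arcs g x₁y (d≤3 a b) in
                     [ proj₁ (x₁-out x₁→y) , proj₂ (x₁-out x₁→y) ]′ y∈uv)

        farPairAvoiding? : ∀ s t → Dec (FarPairAvoiding s t)
        farPairAvoiding? s t = 3 ≤? d s t ×-dec ¬? (s Fin.≟ u) ×-dec ¬? (s Fin.≟ v)
                                         ×-dec ¬? (t Fin.≟ u) ×-dec ¬? (t Fin.≟ v)

        srvColouring : SRVColouring
        srvColouring with any? (λ s → any? (λ t → farPairAvoiding? s t))
        ... | yes (_ , _ , far) = viaFarPair far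
        ... | no none = viaTriple λ far → none (_ , _ , far)

    srvColouring : SRVColouring
    srvColouring with d u v ≤? 2 | d u v ≟ 3
    ... | yes ≤2 | _ =
      (λ _ → Fin.zero) , isSRVColouring⁺ _ λ _ _ _ → inj₂ (small-separated λ a b → ≤-trans (diametral a b) ≤2)
    ... | no ≰2 | yes ≡3 = LargeDiameter.Diameter3.srvColouring (≰⇒> ≰2) ≡3
    ... | no ≰2 | no ≢3 = LargeDiameter.diameter≥4 (≰⇒> ≰2) (≤∧≢⇒< (≰⇒> ≰2) (≢3 ∘ sym))

  srvColouring : SRVColouring
  srvColouring = let (_ , _ , diametral) = diametralPair in Diametral.srvColouring diametral

theorem17 : (n : ℕ) → 3 ≤ n → (T : Digraph n) → IsTournament T → StronglyConnected T →
    ∃₂ λ r s → IsRVC T r × IsSRVC T s × 1 ≤ r × r ≤ s × s ≤ n ∸ 2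
theorem17 (suc (suc (suc m))) (s≤s (s≤s (s≤s _))) T tour sc =
  let (_ , srv) = Construction.srvColouring T tour sc
      (s , srvc , s≤n∸2) = minColours (IsSRVColouring T) (isSRVColouring? T) isSRVColouring-resp srv
      (r , rvc , r≤s) = minColours (IsRVColouring T) (isRVColouring? T) isRVColouring-resp
                                   (isSRVColouring⇒isRVColouring (proj₂ (proj₁ srvc)))
  in r , s , rvc , srvc , colours≥1 (proj₁ (proj₁ rvc)) , r≤s , s≤n∸2
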